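{- Let $H=(V,E)$ be a finite connected bipartite graph without leaf vertices (vertices of degree $1$). (1) If $|E(H)|=4$, then $H=K_{2,2}$ and $\min_{e\in E(H)}|S_1(e)|=|E(H)|-\frac{|V(H)|}{2}$. (2) If $|E(H)|\ge5$, then $\min_{e\in E(H)}|S_1(e)|<|E(H)|-\frac{|V(H)|}{2}$.
   Context: For an edge $e$, $S_1(e)$ is the set of edges different from $e$ sharing an endpoint with $e$. -}

module Defs where

open import Data.Bool using (Bool; true; false; T; _∧_; _∨_; not; _xor_; if_then_else_)
open import Data.Nat using (ℕ; zero; suc; _<ᵇ_; _⊓_; _+_; _*_; _<_; _≤_)
open import Data.Fin using (Fin; toℕ; _≟_)
open import Data.List using (List; []; _∷_; length; filterᵇ; concatMap; map; allFin)
open import Data.Product using (_×_; _,_; Σ; ∃)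
open import Relation.Nullary.Decidable using (⌊_⌋)
open import Relation.Binary.PropositionalEquality using (_≡_; _≢_)
open import Function.Bundles using (Bijection; _⤖_)
open import Function.Base using (_∘_)

record Graph (n : ℕ) : Set where
  field
    adj    : Fin n → Fin n → Bool
    sym    : ∀ u v → adj u v ≡ adj v u
    irrefl : ∀ u → adj u u ≡ false
open Graph public

Edge : ℕ → Set
Edge n = Fin n × Fin n

_==_ : ∀ {n} → Fin n → Fin n → Bool
a == b = ⌊ a ≟ b ⌋

edges : ∀ {n} → Graph n → List (Edge n)
edges {n} G = concatMap (λ i → concatMap (λ j →
  if (toℕ i <ᵇ toℕ j) ∧ adj G i j then (i , j) ∷ [] else []) (allFin n)) (allFin n)

numEdges : ∀ {n} → Graph n → ℕ
numEdges G = length (edges G)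

degree : ∀ {n} → Graph n → Fin n → ℕ
degree {n} G v = length (filterᵇ (adj G v) (allFin n))

sameEdge : ∀ {n} → Edge n → Edge n → Bool
sameEdge (a , b) (c , d) = (a == c) ∧ (b == d)

shareEndpoint : ∀ {n} → Edge n → Edge n → Bool
shareEndpoint (a , b) (c , d) = (a == c) ∨ (a == d) ∨ (b == c) ∨ (b == d)

S₁size : ∀ {n} → Graph n → Edge n → ℕ
S₁size G e = length (filterᵇ (λ f → not (sameEdge e f) ∧ shareEndpoint e f) (edges G))

minList : List ℕ → ℕ
minList []           = 0
minList (x ∷ [])     = x
minList (x ∷ y ∷ xs) = x ⊓ minList (y ∷ xs)

-- min over e ∈ E(H) of |S₁(e)| (only used when E(H) is nonempty).
minS₁ : ∀ {n} → Graph n → ℕ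
minS₁ G = minList (map (S₁size G) (edges G))

data Walk {n} (G : Graph n) : Fin n → Fin n → Set where
  here : ∀ {u} → Walk G u u
  step : ∀ {u v w} → T (adj G u v) → Walk G v w → Walk G u w

Connected : ∀ {n} → Graph n → Set
Connected {n} G = ∀ (u v : Fin n) → Walk G u v

Bipartite : ∀ {n} → Graph n → Set
Bipartite {n} G = Σ (Fin n → Bool) λ c → ∀ u v → T (adj G u v) → c u ≢ c v

NoLeaves : ∀ {n} → Graph n → Set
NoLeaves {n} G = ∀ (v : Fin n) → degree G v ≢ 1

K22 : Graph 4
K22 = record { adj = λ i j → (toℕ i <ᵇ 2) xor (toℕ j <ᵇ 2) ; sym = s ; irrefl = r }
  where
  open import Data.Fin.Patterns
  s : ∀ u v → ((toℕ u <ᵇ 2) xor (toℕ v <ᵇ 2)) ≡ ((toℕ v <ᵇ 2) xor (toℕ u <ᵇ 2))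
  s 0F 0F = _≡_.refl
  s 0F 1F = _≡_.refl
  s 0F 2F = _≡_.refl
  s 0F 3F = _≡_.refl
  s 1F 0F = _≡_.refl
  s 1F 1F = _≡_.refl
  s 1F 2F = _≡_.refl
  s 1F 3F = _≡_.refl
  s 2F 0F = _≡_.refl
  s 2F 1F = _≡_.refl
  s 2F 2F = _≡_.refl
  s 2F 3F = _≡_.refl
  s 3F 0F = _≡_.refl
  s 3F 1F = _≡_.refl
  s 3F 2F = _≡_.refl
  s 3F 3F = _≡_.refl
  r : ∀ u → ((toℕ u <ᵇ 2) xor (toℕ u <ᵇ 2)) ≡ false
  r 0F = _≡_.refl
  r 1F = _≡_.refl
  r 2F = _≡_.refl
  r 3F = _≡_.refl

_≅_ : ∀ {n m} → Graph n → Graph m → Set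
_≅_ {n} {m} G H = Σ (Fin n ⤖ Fin m)
  λ f → ∀ u v → adj G u v ≡ adj H (Bijection.to f u) (Bijection.to f v)

{-# OPTIONS --safe #-}
-- Write d for the degree, m for the number of edges and n for the number of vertices.
-- The edges meeting an edge ij are counted by d(i) + d(j), with ij itself counted twice, so
-- |S₁(ij)| = d(i) + d(j) − 2; in a bipartite graph adjacent vertices have no common
-- neighbour, so d(i) + d(j) ≤ n; connectedness without leaves gives d ≥ 2; and Σ d = 2m.
-- If m = 4 then 2n ≤ Σ d = 8 and n ≥ d(i) + d(j) ≥ 4, so n = 4 and H is 2-regular: every
-- |S₁(e)| equals 2, and a check of the 2⁶ edge sets on four vertices shows that H is a
-- 4-cycle, i.e. K₂,₂. If m ≥ 5 and some x has d(x) ≥ 3, an edge yz avoiding x gives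
-- 2m = Σ d ≥ d(y) + d(z) + 3 + 2(n − 3), which with d(y) + d(z) ≤ n yields
-- 2|S₁(yz)| + n < 2m. Otherwise H is 2-regular, so n = m ≥ 5 and 2·2 + n < 2n.
module Submission where

open import Defs hiding (sym)
open import Data.Nat using (ℕ; _+_; _*_; _<_; _≥_)
open import Data.Product using (_×_)
open import Relation.Binary.PropositionalEquality using (_≡_)

open import Data.Nat.Properties renaming (_≟_ to _≟ℕ_)
open import Algebra.Properties.Semiring.Sum +-*-semiring
  using (sum; sum-syntax; ∑-distrib-+; ∑-comm; sum-cong-≗; *-distribˡ-sum)
open import Data.Bool using (Bool; true; false; T; _∧_; not; if_then_else_)
open import Data.Bool.Properties using (T?; T-≡; T-∧)
open import Data.Empty using (⊥; ⊥-elim)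
open import Data.Fin using (Fin; zero; suc; toℕ; fromℕ<; _≟_)
open import Data.Fin.Patterns using (0F; 1F; 2F; 3F)
open import Data.Fin.Permutation using (Permutation′; transpose; _⟨$⟩ʳ_) renaming (id to idₚ)
open import Data.Fin.Properties using (toℕ-injective; any?)
open import Data.Fin.Subset.Properties using (anySubset?)
open import Data.List using (List; []; _∷_; _++_; length; map; filterᵇ; concatMap; tabulate; allFin)
import Data.List.Properties as List
open import Data.List.Membership.Propositional using (_∈_; lose)
open import Data.List.Membership.Propositional.Properties
  using (∈-allFin; ∈-concatMap⁺; ∈-concatMap⁻; ∈-filter⁺; ∈-filter⁻; ∈-length; ∈-lookup)
open import Data.List.Relation.Unary.All using (_∷_)
open import Data.List.Relation.Unary.AllPairs using (_∷_)
open import Data.List.Relation.Unary.Any using (here; there; satisfied)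
open import Data.List.Relation.Unary.Unique.Propositional using (Unique)
open import Data.List.Relation.Unary.Unique.Propositional.Properties using (allFin⁺; filter⁺)
open import Data.Nat using (zero; suc; _≤_; z≤n; s≤s; _<ᵇ_; _≤?_; _⊓_)
open import Data.Nat.Solver using (module +-*-Solver)
open import Data.Product using (∃; ∃₂; _,_; proj₁; proj₂)
import Data.Product.Properties as Product
open import Data.Sum using (_⊎_; inj₁; inj₂)
open import Data.Unit using (tt)
open import Data.Vec using (Vec; []; _∷_)
open import Function.Base using (_∘_)
open import Function.Bundles using (Equivalence)
open import Function.Properties.Inverse using (↔⇒⤖)
open import Relation.Binary.Definitions using (tri<; tri≈; tri>)
open import Relation.Binary.PropositionalEquality
  using (refl; sym; trans; cong; cong₂; subst; _≢_; module ≡-Reasoning)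
open import Relation.Nullary using (¬_; yes; no; Dec)
open import Relation.Nullary.Decidable using (_→-dec_; ¬?; from-no; decidable-stable)

⟦_⟧ : Bool → ℕ
⟦ true ⟧  = 1
⟦ false ⟧ = 0

⟦∧⟧ : ∀ x y → ⟦ x ∧ y ⟧ ≡ ⟦ x ⟧ * ⟦ y ⟧
⟦∧⟧ true  y = sym (+-identityʳ ⟦ y ⟧)
⟦∧⟧ false y = refl

T-ext : ∀ {x y} → (T x → T y) → (T y → T x) → x ≡ y
T-ext {true}  {true}  _ _ = refl
T-ext {true}  {false} f _ = ⊥-elim (f tt)
T-ext {false} {true}  _ g = ⊥-elim (g tt)
T-ext {false} {false} _ _ = refl

no-three-distinct-bools : ∀ {x y z : Bool} → x ≢ y → x ≢ z → y ≢ z → ⊥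
no-three-distinct-bools {true}  {true}  x≢y _ _ = x≢y refl
no-three-distinct-bools {false} {false} x≢y _ _ = x≢y refl
no-three-distinct-bools {true}  {false} {true}  _ x≢z _ = x≢z refl
no-three-distinct-bools {false} {true}  {false} _ x≢z _ = x≢z refl
no-three-distinct-bools {true}  {false} {false} _ _ y≢z = y≢z refl
no-three-distinct-bools {false} {true}  {true}  _ _ y≢z = y≢z refl

suc-== : ∀ {n} (u v : Fin n) → (suc u == suc v) ≡ (u == v)
suc-== u v with u ≟ v
... | yes _ = refl
... | no  _ = refl

∑-mono-≤ : ∀ {n} {f g : Fin n → ℕ} → (∀ i → f i ≤ g i) → sum f ≤ sum g
∑-mono-≤ {zero}  _   = z≤n
∑-mono-≤ {suc n} f≤g = +-mono-≤ (f≤g zero) (∑-mono-≤ (f≤g ∘ suc))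

∑-mono-≤-tight : ∀ {n} {f g : Fin n → ℕ} → (∀ i → f i ≤ g i) → sum g ≤ sum f → ∀ i → f i ≡ g i
∑-mono-≤-tight {suc n} {f} {g} f≤g ∑g≤∑f zero = ≤-antisym (f≤g zero)
  (+-cancelʳ-≤ _ _ _ (≤-trans ∑g≤∑f (+-monoʳ-≤ (f zero) (∑-mono-≤ (f≤g ∘ suc)))))
∑-mono-≤-tight {suc n} {f} {g} f≤g ∑g≤∑f (suc i) = ∑-mono-≤-tight (f≤g ∘ suc)
  (+-cancelˡ-≤ (g zero) _ _ (≤-trans ∑g≤∑f (+-monoˡ-≤ _ (f≤g zero)))) i

∑-const : ∀ n c → ∑[ i < n ] c ≡ n * c
∑-const zero    c = refl
∑-const (suc n) c = cong (c +_) (∑-const n c)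

∑-δ : ∀ {n} (v : Fin n) (h : Fin n → ℕ) → ∑[ a < n ] (⟦ v == a ⟧ * h a) ≡ h v
∑-δ {suc n} zero    h =
  trans (cong₂ _+_ (+-identityʳ (h zero)) (trans (∑-const n 0) (*-zeroʳ n))) (+-identityʳ (h zero))
∑-δ {suc n} (suc v) h = trans (sum-cong-≗ λ a → cong (λ b → ⟦ b ⟧ * h (suc a)) (suc-== v a)) (∑-δ v (h ∘ suc))

∑-δ₃ : ∀ {n} (i j k : Fin n) (g : Fin n → ℕ) →
  ∑[ w < n ] ((⟦ i == w ⟧ + ⟦ j == w ⟧ + ⟦ k == w ⟧) * g w) ≡ g i + g j + g k
∑-δ₃ {n} i j k g = begin
  ∑[ w < n ] ((⟦ i == w ⟧ + ⟦ j == w ⟧ + ⟦ k == w ⟧) * g w)  ≡⟨ sum-cong-≗ distribute ⟩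
  ∑[ w < n ] (δ i w + δ j w + δ k w)                        ≡⟨ ∑-distrib-+ (λ w → δ i w + δ j w) (δ k) ⟩
  ∑[ w < n ] (δ i w + δ j w) + sum (δ k)                    ≡⟨ cong (_+ sum (δ k)) (∑-distrib-+ (δ i) (δ j)) ⟩
  sum (δ i) + sum (δ j) + sum (δ k)                         ≡⟨ cong₂ _+_ (cong₂ _+_ (∑-δ i g) (∑-δ j g)) (∑-δ k g) ⟩
  g i + g j + g k                                           ∎
  where
  open ≡-Reasoning
  δ : Fin n → Fin n → ℕ
  δ v w = ⟦ v == w ⟧ * g w
  distribute : ∀ w → (⟦ i == w ⟧ + ⟦ j == w ⟧ + ⟦ k == w ⟧) * g w ≡ δ i w + δ j w + δ k w
  distribute w = trans (*-distribʳ-+ (g w) (⟦ i == w ⟧ + ⟦ j == w ⟧) ⟦ k == w ⟧)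
                       (cong (_+ δ k w) (*-distribʳ-+ (g w) ⟦ i == w ⟧ ⟦ j == w ⟧))

∑-three-points : ∀ {n c} (f : Fin n → ℕ) → (∀ w → c ≤ f w) → ∀ {i j k} → i ≢ j → i ≢ k → j ≢ k →
  f i + f j + f k + n * c ≤ sum f + (c + c + c)
∑-three-points {n} {c} f c≤f {i} {j} {k} i≢j i≢k j≢k = begin
  f i + f j + f k + n * c                      ≡⟨ cong₂ _+_ (sym (∑-δ₃ i j k f)) (sym (∑-const n c)) ⟩
  ∑[ w < n ] (marked w * f w) + ∑[ w < n ] c   ≡⟨ sym (∑-distrib-+ (λ w → marked w * f w) (λ _ → c)) ⟩
  ∑[ w < n ] (marked w * f w + c)              ≤⟨ ∑-mono-≤ (λ w → trade (marked≤1 w) (c≤f w)) ⟩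
  ∑[ w < n ] (f w + marked w * c)              ≡⟨ ∑-distrib-+ f (λ w → marked w * c) ⟩
  sum f + ∑[ w < n ] (marked w * c)            ≡⟨ cong (sum f +_) (∑-δ₃ i j k (λ _ → c)) ⟩
  sum f + (c + c + c)                          ∎
  where
  open ≤-Reasoning
  marked : Fin n → ℕ
  marked w = ⟦ i == w ⟧ + ⟦ j == w ⟧ + ⟦ k == w ⟧
  marked≤1 : ∀ w → marked w ≤ 1
  marked≤1 w with i ≟ w | j ≟ w | k ≟ w
  ... | yes refl | yes refl | _        = ⊥-elim (i≢j refl)
  ... | yes refl | no _     | yes refl = ⊥-elim (i≢k refl)
  ... | yes refl | no _     | no _     = ≤-refl
  ... | no _     | yes refl | yes refl = ⊥-elim (j≢k refl)
  ... | no _     | yes refl | no _     = ≤-refl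
  ... | no _     | no _     | yes refl = ≤-refl
  ... | no _     | no _     | no _     = z≤n
  trade : ∀ {m x} → m ≤ 1 → c ≤ x → m * x + c ≤ x + m * c
  trade {zero}        _        c≤x = ≤-trans c≤x (m≤m+n _ 0)
  trade {suc (suc _)} (s≤s ()) _
  trade {suc zero} {x} _      _   =
    ≤-reflexive (trans (cong (_+ c) (+-identityʳ x)) (cong (x +_) (sym (+-identityʳ c))))

countᵇ : ∀ {A : Set} → (A → Bool) → List A → ℕ
countᵇ p xs = length (filterᵇ p xs)

module _ {A : Set} (p : A → Bool) where

  countᵇ-∷ : ∀ x xs → countᵇ p (x ∷ xs) ≡ ⟦ p x ⟧ + countᵇ p xs
  countᵇ-∷ x xs with p x
  ... | true  = refl
  ... | false = refl

  countᵇ-++ : ∀ xs ys → countᵇ p (xs ++ ys) ≡ countᵇ p xs + countᵇ p ys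
  countᵇ-++ xs ys = trans (cong length (List.filter-++ (T? ∘ p) xs ys)) (List.length-++ (filterᵇ p xs))

  countᵇ-tabulate : ∀ {n} (g : Fin n → A) → countᵇ p (tabulate g) ≡ ∑[ i < n ] ⟦ p (g i) ⟧
  countᵇ-tabulate {zero}  g = refl
  countᵇ-tabulate {suc n} g = trans (countᵇ-∷ (g zero) _) (cong (⟦ p (g zero) ⟧ +_) (countᵇ-tabulate (g ∘ suc)))

  countᵇ-concatMap : ∀ {B : Set} {n} (f : B → List A) (g : Fin n → B) →
    countᵇ p (concatMap f (tabulate g)) ≡ ∑[ i < n ] countᵇ p (f (g i))
  countᵇ-concatMap {n = zero}  f g = refl
  countᵇ-concatMap {n = suc n} f g = trans (countᵇ-++ (f (g zero)) _)
    (cong (countᵇ p (f (g zero)) +_) (countᵇ-concatMap f (g ∘ suc)))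

  countᵇ-if : ∀ c x → countᵇ p (if c then x ∷ [] else []) ≡ ⟦ c ⟧ * ⟦ p x ⟧
  countᵇ-if true  x = countᵇ-∷ x []
  countᵇ-if false x = refl

countᵇ-true : ∀ {A : Set} (xs : List A) → countᵇ (λ _ → true) xs ≡ length xs
countᵇ-true []       = refl
countᵇ-true (x ∷ xs) = cong suc (countᵇ-true xs)

minList-≤ : ∀ {A : Set} (f : A → ℕ) {x xs} → x ∈ xs → minList (map f xs) ≤ f x
minList-≤ f {xs = _ ∷ []}    (here refl) = ≤-refl
minList-≤ f {xs = _ ∷ _ ∷ _} (here refl) = m⊓n≤m _ _
minList-≤ f {xs = _ ∷ _ ∷ _} (there x∈) = ≤-trans (m⊓n≤n _ _) (minList-≤ f x∈)

minList-const : ∀ {A : Set} (f : A → ℕ) {c x xs} → x ∈ xs → (∀ {y} → y ∈ xs → f y ≡ c) → minList (map f xs) ≡ c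
minList-const f {xs = _ ∷ []}    _ f≡c = f≡c (here refl)
minList-const f {c} {xs = _ ∷ _ ∷ _} _ f≡c =
  trans (cong₂ _⊓_ (f≡c (here refl)) (minList-const f (here refl) (f≡c ∘ there))) (⊓-idem c)

∃-other-element : ∀ {n} {xs : List (Fin n)} → Unique xs → 2 ≤ length xs → ∀ u → ∃ λ w → w ∈ xs × w ≢ u
∃-other-element {xs = _ ∷ []} _ (s≤s ()) _
∃-other-element {xs = x ∷ y ∷ _} ((x≢y ∷ _) ∷ _) _ u with x ≟ u
... | no  x≢u  = x , here refl , x≢u
... | yes refl = y , there (here refl) , x≢y ∘ sym

incidence : ∀ {n} → Fin n → Edge n → ℕ
incidence v (a , b) = ⟦ v == a ⟧ + ⟦ v == b ⟧

shared-endpoints : ∀ {n} {i j a b : Fin n} → toℕ i < toℕ j → toℕ a < toℕ b →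
  ⟦ not (sameEdge (i , j) (a , b)) ∧ shareEndpoint (i , j) (a , b) ⟧ + ⟦ sameEdge (i , j) (a , b) ⟧ * 2
    ≡ incidence i (a , b) + incidence j (a , b)
shared-endpoints {i = i} {j} {a} {b} i<j a<b with i ≟ a | i ≟ b | j ≟ a | j ≟ b
... | yes refl | yes refl | _        | _        = ⊥-elim (<-irrefl refl a<b)
... | yes refl | no _     | yes refl | _        = ⊥-elim (<-irrefl refl i<j)
... | yes refl | no _     | no _     | yes refl = refl
... | yes refl | no _     | no _     | no _     = refl
... | no _     | yes refl | yes refl | _        = ⊥-elim (<-asym i<j a<b)
... | no _     | yes refl | no _     | yes refl = ⊥-elim (<-irrefl refl i<j)
... | no _     | yes refl | no _     | no _     = refl
... | no _     | no _     | yes refl | yes refl = ⊥-elim (<-irrefl refl a<b)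
... | no _     | no _     | yes refl | no _     = refl
... | no _     | no _     | no _     | yes refl = refl
... | no _     | no _     | no _     | no _     = refl

module _ {n} (G : Graph n) where

  adj< : Fin n → Fin n → Bool
  adj< a b = (toℕ a <ᵇ toℕ b) ∧ adj G a b

  adj<⇒< : ∀ {a b} → T (adj< a b) → toℕ a < toℕ b
  adj<⇒< {a} {b} t = <ᵇ⇒< (toℕ a) (toℕ b) (proj₁ (Equivalence.to T-∧ t))

  adj<⇒adj : ∀ {a b} → T (adj< a b) → T (adj G a b)
  adj<⇒adj {a} {b} t = proj₂ (Equivalence.to (T-∧ {toℕ a <ᵇ toℕ b}) t)

  adj<-of-< : ∀ {a b} → toℕ a < toℕ b → adj< a b ≡ adj G a b
  adj<-of-< a<b rewrite Equivalence.to T-≡ (<⇒<ᵇ a<b) = refl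

  adj<-of-≮ : ∀ {a b} → ¬ toℕ a < toℕ b → adj< a b ≡ false
  adj<-of-≮ {a} {b} a≮b with toℕ a <ᵇ toℕ b | <ᵇ⇒< (toℕ a) (toℕ b)
  ... | false | _   = refl
  ... | true  | a<b = ⊥-elim (a≮b (a<b tt))

  adj-irrefl : ∀ {a b} → T (adj G a b) → a ≢ b
  adj-irrefl {a} t refl = subst T (irrefl G a) t

  adj⇒adj< : ∀ {a b} → T (adj G a b) → T (adj< a b) ⊎ T (adj< b a)
  adj⇒adj< {a} {b} t with <-cmp (toℕ a) (toℕ b)
  ... | tri< a<b _ _ = inj₁ (subst T (sym (adj<-of-< a<b)) t)
  ... | tri≈ _ a≡b _ = ⊥-elim (adj-irrefl t (toℕ-injective a≡b))
  ... | tri> _ _ b<a = inj₂ (subst T (sym (trans (adj<-of-< b<a) (Graph.sym G b a))) t)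

  ⟦adj⟧-split : ∀ a b → ⟦ adj G a b ⟧ ≡ ⟦ adj< a b ⟧ + ⟦ adj< b a ⟧
  ⟦adj⟧-split a b with <-cmp (toℕ a) (toℕ b)
  ... | tri< a<b _ b≮a rewrite adj<-of-< a<b | adj<-of-≮ b≮a = sym (+-identityʳ _)
  ... | tri> a≮b _ b<a rewrite adj<-of-≮ a≮b | adj<-of-< b<a = cong ⟦_⟧ (Graph.sym G a b)
  ... | tri≈ _ a≡b _ with toℕ-injective a≡b
  ... | refl = trans (cong ⟦_⟧ (irrefl G a)) (sym (cong₂ _+_ never never))
    where
    never : ⟦ adj< a a ⟧ ≡ 0
    never = cong ⟦_⟧ (adj<-of-≮ {a} {a} (<-irrefl refl))

  ∑ₑ-from : Fin n → (Edge n → ℕ) → ℕ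
  ∑ₑ-from a w = ∑[ b < n ] (⟦ adj< a b ⟧ * w (a , b))

  ∑ₑ : (Edge n → ℕ) → ℕ
  ∑ₑ w = ∑[ a < n ] ∑ₑ-from a w

  ∑ₑ-cong : ∀ {w w′ : Edge n → ℕ} → (∀ {a b} → T (adj< a b) → w (a , b) ≡ w′ (a , b)) → ∑ₑ w ≡ ∑ₑ w′
  ∑ₑ-cong {w} {w′} w≡w′ = sum-cong-≗ λ a → sum-cong-≗ λ b → on-edges a b
    where
    on-edges : ∀ a b → ⟦ adj< a b ⟧ * w (a , b) ≡ ⟦ adj< a b ⟧ * w′ (a , b)
    on-edges a b with adj< a b | w≡w′ {a} {b}
    ... | true  | eq = cong (_+ 0) (eq tt)
    ... | false | _  = refl

  ∑ₑ-+ : ∀ (w w′ : Edge n → ℕ) → ∑ₑ (λ e → w e + w′ e) ≡ ∑ₑ w + ∑ₑ w′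
  ∑ₑ-+ w w′ = trans (sum-cong-≗ from-a) (∑-distrib-+ (λ a → ∑ₑ-from a w) (λ a → ∑ₑ-from a w′))
    where
    from-a : ∀ a → ∑ₑ-from a (λ e → w e + w′ e) ≡ ∑ₑ-from a w + ∑ₑ-from a w′
    from-a a = trans (sum-cong-≗ λ b → *-distribˡ-+ ⟦ adj< a b ⟧ (w (a , b)) (w′ (a , b)))
      (∑-distrib-+ (λ b → ⟦ adj< a b ⟧ * w (a , b)) (λ b → ⟦ adj< a b ⟧ * w′ (a , b)))

  edge-if : Fin n → Fin n → List (Edge n)
  edge-if a b = if adj< a b then (a , b) ∷ [] else []

  edges-from : Fin n → List (Edge n)
  edges-from a = concatMap (edge-if a) (allFin n)

  countᵇ-edges : ∀ p → countᵇ p (edges G) ≡ ∑ₑ (⟦_⟧ ∘ p)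
  countᵇ-edges p = trans (countᵇ-concatMap p edges-from (λ a → a))
    (sum-cong-≗ λ a → trans (countᵇ-concatMap p (edge-if a) (λ b → b))
      (sum-cong-≗ λ b → countᵇ-if p (adj< a b) (a , b)))

  numEdges-∑ : numEdges G ≡ ∑[ a < n ] ∑[ b < n ] ⟦ adj< a b ⟧
  numEdges-∑ = trans (sym (countᵇ-true (edges G))) (trans (countᵇ-edges (λ _ → true))
    (sum-cong-≗ λ a → sum-cong-≗ λ b → *-identityʳ ⟦ adj< a b ⟧))

  degree-∑ : ∀ v → degree G v ≡ ∑[ w < n ] ⟦ adj G v w ⟧
  degree-∑ v = countᵇ-tabulate (adj G v) (λ w → w)

  degree⁺ degree⁻ : Fin n → ℕ
  degree⁺ v = ∑[ w < n ] ⟦ adj< v w ⟧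
  degree⁻ v = ∑[ w < n ] ⟦ adj< w v ⟧

  degree-split : ∀ v → degree G v ≡ degree⁺ v + degree⁻ v
  degree-split v = trans (degree-∑ v)
    (trans (sum-cong-≗ (⟦adj⟧-split v)) (∑-distrib-+ (⟦_⟧ ∘ adj< v) (λ w → ⟦ adj< w v ⟧)))

  handshake : ∑[ v < n ] degree G v ≡ 2 * numEdges G
  handshake = begin
    ∑[ v < n ] degree G v                 ≡⟨ sum-cong-≗ degree-split ⟩
    ∑[ v < n ] (degree⁺ v + degree⁻ v)    ≡⟨ ∑-distrib-+ degree⁺ degree⁻ ⟩
    N + ∑[ v < n ] degree⁻ v              ≡⟨ cong (N +_) (∑-comm (λ v w → ⟦ adj< w v ⟧)) ⟩
    N + N                                 ≡⟨ cong (N +_) (sym (+-identityʳ N)) ⟩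
    2 * N                                 ≡⟨ cong (2 *_) (sym numEdges-∑) ⟩
    2 * numEdges G                        ∎
    where
    open ≡-Reasoning
    N : ℕ
    N = ∑[ a < n ] ∑[ b < n ] ⟦ adj< a b ⟧

  ∑ₑ-incidence : ∀ v → ∑ₑ (incidence v) ≡ degree G v
  ∑ₑ-incidence v = begin
    ∑ₑ (incidence v)                                          ≡⟨ ∑ₑ-+ _ _ ⟩
    ∑ₑ (λ e → ⟦ v == proj₁ e ⟧) + ∑ₑ (λ e → ⟦ v == proj₂ e ⟧) ≡⟨ cong₂ _+_ as-first as-second ⟩
    degree⁺ v + degree⁻ v                                     ≡⟨ sym (degree-split v) ⟩
    degree G v                                                ∎
    where
    open ≡-Reasoning
    as-first : ∑ₑ (λ e → ⟦ v == proj₁ e ⟧) ≡ degree⁺ v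
    as-first = trans
      (sum-cong-≗ λ a → trans (sum-cong-≗ λ b → *-comm ⟦ adj< a b ⟧ ⟦ v == a ⟧)
                              (sym (*-distribˡ-sum ⟦ v == a ⟧ (⟦_⟧ ∘ adj< a))))
      (∑-δ v (λ a → ∑[ b < n ] ⟦ adj< a b ⟧))
    as-second : ∑ₑ (λ e → ⟦ v == proj₂ e ⟧) ≡ degree⁻ v
    as-second = sum-cong-≗ λ a →
      trans (sum-cong-≗ λ b → *-comm ⟦ adj< a b ⟧ ⟦ v == b ⟧) (∑-δ v (λ b → ⟦ adj< a b ⟧))

  ∑ₑ-sameEdge : ∀ {i j} → T (adj< i j) → (h : Edge n → ℕ) →
    ∑ₑ (λ e → ⟦ sameEdge (i , j) e ⟧ * h e) ≡ h (i , j)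
  ∑ₑ-sameEdge {i} {j} t h = begin
    ∑ₑ (λ e → ⟦ sameEdge (i , j) e ⟧ * h e)              ≡⟨ sum-cong-≗ (λ a → sum-cong-≗ (reorder a)) ⟩
    ∑[ a < n ] ∑[ b < n ] (⟦ i == a ⟧ * rest a b)        ≡⟨ sum-cong-≗ (λ a → sym (*-distribˡ-sum ⟦ i == a ⟧ (rest a))) ⟩
    ∑[ a < n ] (⟦ i == a ⟧ * ∑[ b < n ] rest a b)        ≡⟨ ∑-δ i (sum ∘ rest) ⟩
    ∑[ b < n ] (⟦ j == b ⟧ * (⟦ adj< i b ⟧ * h (i , b))) ≡⟨ ∑-δ j (λ b → ⟦ adj< i b ⟧ * h (i , b)) ⟩
    ⟦ adj< i j ⟧ * h (i , j)                             ≡⟨ cong (λ x → ⟦ x ⟧ * h (i , j)) (Equivalence.to T-≡ t) ⟩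
    1 * h (i , j)                                        ≡⟨ *-identityˡ _ ⟩
    h (i , j)                                            ∎
    where
    open ≡-Reasoning
    open +-*-Solver using (solve; _:*_; _:=_)
    rest : Fin n → Fin n → ℕ
    rest a b = ⟦ j == b ⟧ * (⟦ adj< a b ⟧ * h (a , b))
    reorder : ∀ a b → ⟦ adj< a b ⟧ * (⟦ (i == a) ∧ (j == b) ⟧ * h (a , b)) ≡ ⟦ i == a ⟧ * rest a b
    reorder a b rewrite ⟦∧⟧ (i == a) (j == b) =
      solve 4 (λ x y z w → x :* (y :* z :* w) := y :* (z :* (x :* w))) refl
        ⟦ adj< a b ⟧ ⟦ i == a ⟧ ⟦ j == b ⟧ (h (a , b))

  S₁size+2≡ : ∀ {i j} → T (adj< i j) → S₁size G (i , j) + 2 ≡ degree G i + degree G j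
  S₁size+2≡ {i} {j} t = begin
    S₁size G (i , j) + 2                                        ≡⟨ cong₂ _+_ (countᵇ-edges _) (sym (∑ₑ-sameEdge t (λ _ → 2))) ⟩
    ∑ₑ (⟦_⟧ ∘ meets) + ∑ₑ (λ e → ⟦ sameEdge (i , j) e ⟧ * 2)    ≡⟨ sym (∑ₑ-+ _ _) ⟩
    ∑ₑ (λ e → ⟦ meets e ⟧ + ⟦ sameEdge (i , j) e ⟧ * 2)         ≡⟨ ∑ₑ-cong (shared-endpoints (adj<⇒< t) ∘ adj<⇒<) ⟩
    ∑ₑ (λ e → incidence i e + incidence j e)                    ≡⟨ ∑ₑ-+ _ _ ⟩
    ∑ₑ (incidence i) + ∑ₑ (incidence j)                         ≡⟨ cong₂ _+_ (∑ₑ-incidence i) (∑ₑ-incidence j) ⟩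
    degree G i + degree G j                                     ∎
    where
    open ≡-Reasoning
    meets : Edge n → Bool
    meets e = not (sameEdge (i , j) e) ∧ shareEndpoint (i , j) e

  ∈-edges⁺ : ∀ {a b} → T (adj< a b) → (a , b) ∈ edges G
  ∈-edges⁺ {a} {b} t =
    ∈-concatMap⁺ edges-from (lose (∈-allFin a) (∈-concatMap⁺ (edge-if a) (lose (∈-allFin b) (∈-edge-if t))))
    where
    ∈-edge-if : T (adj< a b) → (a , b) ∈ edge-if a b
    ∈-edge-if t with adj< a b
    ... | true = here refl

  ∈-edges⁻ : ∀ {a b} → (a , b) ∈ edges G → T (adj< a b)
  ∈-edges⁻ e∈ with satisfied (∈-concatMap⁻ edges-from {allFin n} e∈)
  ... | a , e∈from with satisfied (∈-concatMap⁻ (edge-if a) {allFin n} e∈from)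
  ... | b , e∈if = ∈-edge-if⁻ e∈if
    where
    ∈-edge-if⁻ : ∀ {e} → e ∈ edge-if a b → T (adj< (proj₁ e) (proj₂ e))
    ∈-edge-if⁻ e∈ with adj< a b in eq
    ∈-edge-if⁻ (here refl) | true = subst T (sym eq) tt

  edge-exists : 0 < numEdges G → ∃₂ λ a b → T (adj< a b)
  edge-exists m>0 = _ , _ , ∈-edges⁻ (∈-lookup {xs = edges G} (fromℕ< m>0))

  minS₁-≤ : ∀ {a b} → T (adj< a b) → minS₁ G ≤ S₁size G (a , b)
  minS₁-≤ t = minList-≤ (S₁size G) (∈-edges⁺ t)

  minS₁+2≤ : ∀ {u v} → T (adj G u v) → minS₁ G + 2 ≤ degree G u + degree G v
  minS₁+2≤ {u} {v} t with adj⇒adj< t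
  ... | inj₁ t< = ≤-trans (+-monoˡ-≤ 2 (minS₁-≤ t<)) (≤-reflexive (S₁size+2≡ t<))
  ... | inj₂ t> = ≤-trans (+-monoˡ-≤ 2 (minS₁-≤ t>))
                          (≤-reflexive (trans (S₁size+2≡ t>) (+-comm (degree G v) (degree G u))))

  no-common-neighbour : Bipartite G → ∀ {u v w} → T (adj G u v) → T (adj G u w) → T (adj G v w) → ⊥
  no-common-neighbour (colour , proper) uv uw vw =
    no-three-distinct-bools (proper _ _ uv) (proper _ _ uw) (proper _ _ vw)

  adjacent-degrees≤ : Bipartite G → ∀ {u v} → T (adj G u v) → degree G u + degree G v ≤ n
  adjacent-degrees≤ bip {u} {v} uv = begin
    degree G u + degree G v                               ≡⟨ cong₂ _+_ (degree-∑ u) (degree-∑ v) ⟩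
    ∑[ w < n ] ⟦ adj G u w ⟧ + ∑[ w < n ] ⟦ adj G v w ⟧   ≡⟨ sym (∑-distrib-+ (⟦_⟧ ∘ adj G u) (⟦_⟧ ∘ adj G v)) ⟩
    ∑[ w < n ] (⟦ adj G u w ⟧ + ⟦ adj G v w ⟧)           ≤⟨ ∑-mono-≤ at-most-one ⟩
    ∑[ w < n ] 1                                          ≡⟨ trans (∑-const n 1) (*-identityʳ n) ⟩
    n                                                     ∎
    where
    open ≤-Reasoning
    at-most-one : ∀ w → ⟦ adj G u w ⟧ + ⟦ adj G v w ⟧ ≤ 1
    at-most-one w with adj G u w in uw | adj G v w in vw
    ... | true  | true  = ⊥-elim (no-common-neighbour bip uv (subst T (sym uw) tt) (subst T (sym vw) tt))
    ... | true  | false = ≤-refl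
    ... | false | true  = ≤-refl
    ... | false | false = z≤n

  ∃-neighbour-≢ : ∀ {v} → 2 ≤ degree G v → ∀ u → ∃ λ w → w ≢ u × T (adj G v w)
  ∃-neighbour-≢ {v} d≥2 u with ∃-other-element (filter⁺ (T? ∘ adj G v) (allFin⁺ n)) d≥2 u
  ... | w , w∈ , w≢u = w , w≢u , proj₂ (∈-filter⁻ (T? ∘ adj G v) {xs = allFin n} w∈)

  adj⇒degree≥1 : ∀ {v w} → T (adj G v w) → 1 ≤ degree G v
  adj⇒degree≥1 {v} {w} t = ∈-length (∈-filter⁺ (T? ∘ adj G v) (∈-allFin w) t)

  walk⇒degree≥2 : NoLeaves G → ∀ {v u} → Walk G v u → v ≢ u → 2 ≤ degree G v
  walk⇒degree≥2 noLeaf here       v≢v = ⊥-elim (v≢v refl)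
  walk⇒degree≥2 noLeaf (step t _) _   = ≤∧≢⇒< (adj⇒degree≥1 t) (noLeaf _ ∘ sym)

  min-degree≥2 : Connected G → NoLeaves G → 0 < numEdges G → ∀ v → 2 ≤ degree G v
  min-degree≥2 conn noLeaf m>0 v with edge-exists m>0
  ... | a , b , t with v ≟ a
  ... | yes refl = walk⇒degree≥2 noLeaf (conn v b) (<⇒≢ (adj<⇒< t) ∘ cong toℕ)
  ... | no v≢a   = walk⇒degree≥2 noLeaf (conn v a) v≢a

adj<-≡⇒adj-≡ : ∀ {n} (G G′ : Graph n) → (∀ u v → adj< G u v ≡ adj< G′ u v) → ∀ u v → adj G u v ≡ adj G′ u v
adj<-≡⇒adj-≡ G G′ adj<≡ u v with <-cmp (toℕ u) (toℕ v)
... | tri< u<v _ _ = trans (sym (adj<-of-< G u<v)) (trans (adj<≡ u v) (adj<-of-< G′ u<v))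
... | tri> _ _ v<u = trans (Graph.sym G u v)
  (trans (sym (adj<-of-< G v<u)) (trans (adj<≡ v u) (trans (adj<-of-< G′ v<u) (Graph.sym G′ v u))))
... | tri≈ _ u≡v _ rewrite toℕ-injective u≡v = trans (irrefl G v) (sym (irrefl G′ v))

edges-≡⇒adj-≡ : ∀ {n} (G G′ : Graph n) → edges G ≡ edges G′ → ∀ u v → adj G u v ≡ adj G′ u v
edges-≡⇒adj-≡ G G′ same = adj<-≡⇒adj-≡ G G′ λ u v →
  T-ext (∈-edges⁻ G′ ∘ subst (_ ∈_) same ∘ ∈-edges⁺ G) (∈-edges⁻ G ∘ subst (_ ∈_) (sym same) ∘ ∈-edges⁺ G′)

pullback : ∀ {m n} → Graph m → (Fin n → Fin m) → Graph n
pullback G f = record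
  { adj    = λ u v → adj G (f u) (f v)
  ; sym    = λ u v → Graph.sym G (f u) (f v)
  ; irrefl = λ u → irrefl G (f u)
  }

edgesOf : ∀ {n} → (Fin n → Fin n → Bool) → List (Edge n)
edgesOf {n} a = concatMap (λ i → concatMap (λ j →
  if (toℕ i <ᵇ toℕ j) ∧ a i j then (i , j) ∷ [] else []) (allFin n)) (allFin n)

upperBits : Graph 4 → Vec Bool 6
upperBits H = adj H 0F 1F ∷ adj H 0F 2F ∷ adj H 0F 3F ∷ adj H 1F 2F ∷ adj H 1F 3F ∷ adj H 2F 3F ∷ []

-- Entries on or below the diagonal are never read by edgesOf; they are filled with false.
fromUpperBits : Vec Bool 6 → Fin 4 → Fin 4 → Bool
fromUpperBits (b01 ∷ b02 ∷ b03 ∷ b12 ∷ b13 ∷ b23 ∷ []) = λ where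
  0F 1F → b01 ; 0F 2F → b02 ; 0F 3F → b03 ; 1F 2F → b12 ; 1F 3F → b13 ; 2F 3F → b23 ; _ _ → false

triangleFree : (Fin 4 → Fin 4 → Bool) → Bool
triangleFree a = not (a 0F 1F ∧ a 0F 2F ∧ a 1F 2F) ∧ not (a 0F 1F ∧ a 0F 3F ∧ a 1F 3F)
               ∧ not (a 0F 2F ∧ a 0F 3F ∧ a 2F 3F) ∧ not (a 1F 2F ∧ a 1F 3F ∧ a 2F 3F)

-- A 4-cycle through 0 misses exactly one of the pairs 01, 02, 03; the vertex opposite 0 is
-- sent to 1, so that it joins 0 on one side of K22.
C4-relabelling : Vec Bool 6 → Permutation′ 4
C4-relabelling (false ∷ _)        = idₚ
C4-relabelling (true ∷ false ∷ _) = transpose 1F 2F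
C4-relabelling (true ∷ true ∷ _)  = transpose 1F 3F

IsRelabelledK22 : Vec Bool 6 → Set
IsRelabelledK22 s = length (edgesOf (fromUpperBits s)) ≡ 4 → T (triangleFree (fromUpperBits s)) →
  edgesOf (fromUpperBits s) ≡ edges (pullback K22 (C4-relabelling s ⟨$⟩ʳ_))

isRelabelledK22? : ∀ s → Dec (IsRelabelledK22 s)
isRelabelledK22? s = (length (edgesOf (fromUpperBits s)) ≟ℕ 4) →-dec T? _ →-dec
  List.≡-dec (Product.≡-dec _≟_ _≟_) (edgesOf (fromUpperBits s)) _

-- Decided by evaluating all 2⁶ bit vectors.
isRelabelledK22 : ∀ s → IsRelabelledK22 s
isRelabelledK22 s = decidable-stable (isRelabelledK22? s) λ ¬k22 →
  from-no (anySubset? (¬? ∘ isRelabelledK22?)) (s , ¬k22)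

bipartite⇒triangleFree : (H : Graph 4) → Bipartite H → T (triangleFree (adj H))
bipartite⇒triangleFree H bip = ∧-intro (no-triangle 0F 1F 2F) (∧-intro (no-triangle 0F 1F 3F)
                               (∧-intro (no-triangle 0F 2F 3F) (no-triangle 1F 2F 3F)))
  where
  ∧-intro : ∀ {x y} → T x → T y → T (x ∧ y)
  ∧-intro p q = Equivalence.from T-∧ (p , q)
  no-triangle : ∀ u v w → T (not (adj H u v ∧ adj H u w ∧ adj H v w))
  no-triangle u v w with adj H u v in uv | adj H u w in uw | adj H v w in vw
  ... | true  | true  | true  =
    no-common-neighbour H bip (subst T (sym uv) tt) (subst T (sym uw) tt) (subst T (sym vw) tt)
  ... | true  | true  | false = tt
  ... | true  | false | _     = tt
  ... | false | _     | _     = tt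

-- m≡4 is handed to isRelabelledK22 as it stands: edges H and
-- edgesOf (fromUpperBits (upperBits H)) are definitionally equal.
≅-K22 : (H : Graph 4) → Bipartite H → numEdges H ≡ 4 → H ≅ K22
≅-K22 H bip m≡4 = ↔⇒⤖ π , edges-≡⇒adj-≡ H (pullback K22 (π ⟨$⟩ʳ_))
  (isRelabelledK22 (upperBits H) m≡4 (bipartite⇒triangleFree H bip))
  where
  π : Permutation′ 4
  π = C4-relabelling (upperBits H)

module _ {n} (G : Graph n) where

  2-regular⇒edges≡order : (∀ v → degree G v ≡ 2) → numEdges G ≡ n
  2-regular⇒edges≡order regular = *-cancelˡ-≡ (numEdges G) n 2 (begin
    2 * numEdges G          ≡⟨ sym (handshake G) ⟩
    ∑[ v < n ] degree G v   ≡⟨ sum-cong-≗ regular ⟩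
    ∑[ v < n ] 2            ≡⟨ ∑-const n 2 ⟩
    n * 2                   ≡⟨ *-comm n 2 ⟩
    2 * n                   ∎)
    where open ≡-Reasoning

  edges≡order⇒2-regular : (∀ v → 2 ≤ degree G v) → numEdges G ≡ n → ∀ v → degree G v ≡ 2
  edges≡order⇒2-regular δ≥2 m≡n v = sym (∑-mono-≤-tight δ≥2 (≤-reflexive (begin
    ∑[ v < n ] degree G v   ≡⟨ handshake G ⟩
    2 * numEdges G          ≡⟨ cong (2 *_) m≡n ⟩
    2 * n                   ≡⟨ *-comm 2 n ⟩
    n * 2                   ≡⟨ sym (∑-const n 2) ⟩
    ∑[ v < n ] 2            ∎)) v)
    where open ≡-Reasoning

  2-regular⇒minS₁≡2 : 0 < numEdges G → (∀ v → degree G v ≡ 2) → minS₁ G ≡ 2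
  2-regular⇒minS₁≡2 m>0 regular with edge-exists G m>0
  ... | a , b , t = minList-const (S₁size G) (∈-edges⁺ G t) λ {(u , v)} e∈ → +-cancelʳ-≡ 2 (S₁size G (u , v)) 2
    (trans (S₁size+2≡ G (∈-edges⁻ G e∈)) (cong₂ _+_ (regular u) (regular v)))

  four-edges⇒order≡4 : Connected G → Bipartite G → NoLeaves G → numEdges G ≡ 4 → n ≡ 4
  four-edges⇒order≡4 conn bip noLeaf m≡4 = ≤-antisym n≤4 4≤n
    where
    m>0 : 0 < numEdges G
    m>0 = ≤-trans (s≤s z≤n) (≤-reflexive (sym m≡4))
    δ≥2 : ∀ v → 2 ≤ degree G v
    δ≥2 = min-degree≥2 G conn noLeaf m>0
    n≤4 : n ≤ 4
    n≤4 = *-cancelʳ-≤ n 4 2 (begin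
      n * 2                   ≡⟨ sym (∑-const n 2) ⟩
      ∑[ v < n ] 2            ≤⟨ ∑-mono-≤ δ≥2 ⟩
      ∑[ v < n ] degree G v   ≡⟨ handshake G ⟩
      2 * numEdges G          ≡⟨ cong (2 *_) m≡4 ⟩
      8                       ∎)
      where open ≤-Reasoning
    4≤n : 4 ≤ n
    4≤n with edge-exists G m>0
    ... | a , b , t = ≤-trans (+-mono-≤ (δ≥2 a) (δ≥2 b)) (adjacent-degrees≤ G bip (adj<⇒adj G t))

  degree≥3⇒strict-bound : Bipartite G → (∀ v → 2 ≤ degree G v) → ∀ x → 3 ≤ degree G x →
    2 * minS₁ G + n < 2 * numEdges G
  degree≥3⇒strict-bound bip δ≥2 x dx≥3 with ∃-neighbour-≢ G (δ≥2 x) x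
  ... | y , y≢x , xy with ∃-neighbour-≢ G (δ≥2 y) x
  ... | z , z≢x , yz = +-cancelʳ-≤ 6 (suc (2 * μ + n)) (2 * numEdges G) (begin
    suc (2 * μ + n) + 6               ≡⟨ solve 2 (λ μ n → con 1 :+ (con 2 :* μ :+ n) :+ con 6
                                                   := (μ :+ con 2) :+ (μ :+ con 2) :+ (n :+ con 3)) refl μ n ⟩
    (μ + 2) + (μ + 2) + (n + 3)       ≤⟨ +-mono-≤ (+-mono-≤ μ+2≤s (≤-trans μ+2≤s s≤n)) (+-monoʳ-≤ n dx≥3) ⟩
    s + n + (n + degree G x)          ≡⟨ solve 3 (λ s n t → s :+ n :+ (n :+ t) := s :+ t :+ n :* con 2) refl s n (degree G x) ⟩
    s + degree G x + n * 2            ≤⟨ ∑-three-points (degree G) δ≥2 (adj-irrefl G yz) y≢x z≢x ⟩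
    ∑[ v < n ] degree G v + 6         ≡⟨ cong (_+ 6) (handshake G) ⟩
    2 * numEdges G + 6                ∎)
    where
    open ≤-Reasoning
    open +-*-Solver using (solve; _:+_; _:*_; _:=_; con)
    μ s : ℕ
    μ = minS₁ G
    s = degree G y + degree G z
    μ+2≤s : μ + 2 ≤ s
    μ+2≤s = minS₁+2≤ G yz
    s≤n : s ≤ n
    s≤n = adjacent-degrees≤ G bip yz

  2-regular⇒strict-bound : (∀ v → degree G v ≡ 2) → 5 ≤ numEdges G → 2 * minS₁ G + n < 2 * numEdges G
  2-regular⇒strict-bound regular m≥5 with edge-exists G (≤-trans (s≤s z≤n) m≥5)
  ... | a , b , t rewrite 2-regular⇒edges≡order regular = begin-strict
    2 * minS₁ G + n       ≤⟨ +-monoˡ-≤ n (*-monoʳ-≤ 2 μ≤2) ⟩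
    4 + n                 <⟨ +-monoˡ-< n m≥5 ⟩
    n + n                 ≡⟨ cong (n +_) (sym (+-identityʳ n)) ⟩
    2 * n                 ∎
    where
    open ≤-Reasoning
    μ≤2 : minS₁ G ≤ 2
    μ≤2 = +-cancelʳ-≤ 2 (minS₁ G) 2
      (≤-trans (minS₁+2≤ G (adj<⇒adj G t)) (≤-reflexive (cong₂ _+_ (regular a) (regular b))))

lemma3p5 : ∀ {n : ℕ} (H : Graph n) → Connected H → Bipartite H → NoLeaves H →
    (numEdges H ≡ 4 → (H ≅ K22) × (2 * minS₁ H + n ≡ 2 * numEdges H))
    × (numEdges H ≥ 5 → 2 * minS₁ H + n < 2 * numEdges H)
lemma3p5 {n} H conn bip noLeaf = part₁ , part₂
  where
  δ≥2 : ∀ {k} → numEdges H ≥ suc k → ∀ v → 2 ≤ degree H v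
  δ≥2 m>k = min-degree≥2 H conn noLeaf (≤-trans (s≤s z≤n) m>k)

  part₁ : numEdges H ≡ 4 → (H ≅ K22) × (2 * minS₁ H + n ≡ 2 * numEdges H)
  part₁ m≡4 with four-edges⇒order≡4 H conn bip noLeaf m≡4
  ... | refl = ≅-K22 H bip m≡4 , (begin
    2 * minS₁ H + 4   ≡⟨ cong (λ μ → 2 * μ + 4) (2-regular⇒minS₁≡2 H m>0 regular) ⟩
    8                 ≡⟨ cong (2 *_) (sym m≡4) ⟩
    2 * numEdges H    ∎)
    where
    open ≡-Reasoning
    m>0 : 0 < numEdges H
    m>0 = ≤-trans (s≤s z≤n) (≤-reflexive (sym m≡4))
    regular : ∀ v → degree H v ≡ 2
    regular = edges≡order⇒2-regular H (δ≥2 m>0) m≡4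

  part₂ : numEdges H ≥ 5 → 2 * minS₁ H + n < 2 * numEdges H
  part₂ m≥5 with any? (λ x → 3 ≤? degree H x)
  ... | yes (x , dx≥3) = degree≥3⇒strict-bound H bip (δ≥2 m≥5) x dx≥3
  ... | no ∄dx≥3       = 2-regular⇒strict-bound H (λ v → ≤-antisym (≮⇒≥ (∄dx≥3 ∘ (v ,_))) (δ≥2 m≥5 v)) m≥5
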